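{- The map $\varphi : \mathbb{Z}^3 \to \mathbb{Z}^2$ defined by $\varphi(x,y,z) = (Ax - By,\; By - Cz)$, applied pointwise to walks, is a bijection between generalized 3-ballot walks ending at $(an,bn,cn)$ and large tandem excursions (walks from $(0,0)$ back to $(0,0)$ in the quarter plane) with steps $(A,0), (-B,B), (0,-C)$ of the same length.
   Context: Let $a,b,c$ be positive integers with $\gcd(a,b,c)=1$, let $M=\operatorname{lcm}(a,b,c)$, and set $A = M/a$, $B = M/b$, $C = M/c$. Generalized 3-ballot walks are lattice walks from the origin $(0,0,0)$ to $(an,bn,cn)$ using the unit steps $(1,0,0),(0,1,0),(0,0,1)$ that stay in the region $Ax \ge By \ge Cz \ge 0$. Large tandem walks (for positive integers $A,B,C$ with $\gcd(A,B,C)=1$) are walks starting at $(0,0)$ using the steps $(A,0), (-B,B), (0,-C)$ that stay in the quarter plane $\{(x,y)\in\mathbb{Z}^2 : x,y \ge 0\}$; large tandem excursions are such walks ending at $(0,0)$. -}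

module Defs where

open import Data.Nat as ℕ using (ℕ; _>_; >-nonZero)
open import Data.Nat.DivMod using (_/_)
open import Data.Nat.LCM using (lcm)
open import Data.Integer using (ℤ; +_; _+_; _-_; _*_; _≤_; -_)
open import Data.Product using (_×_; _,_)
open import Data.Sum using (_⊎_)
open import Data.List using (List; length; head; last; map)
open import Data.List.Relation.Unary.All using (All)
open import Data.List.Relation.Unary.Linked using (Linked)
open import Data.Maybe using (just)
open import Relation.Binary.PropositionalEquality using (_≡_)

ℤ³ : Set
ℤ³ = ℤ × ℤ × ℤ

ℤ² : Set
ℤ² = ℤ × ℤ

lcm3 : ℕ → ℕ → ℕ → ℕ
lcm3 a b c = lcm a (lcm b c)

divPos : (m d : ℕ) → d > 0 → ℕ
divPos m d d>0 = _/_ m d {{>-nonZero d>0}}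

-- A walk is represented by its list of vertices p₀, p₁, …, p_L
-- (a walk of length L has L+1 vertices).

Step3 : ℤ³ → ℤ³ → Set
Step3 (x , y , z) q =
  q ≡ (x + + 1 , y , z) ⊎ q ≡ (x , y + + 1 , z) ⊎ q ≡ (x , y , z + + 1)

InBallotRegion : ℕ → ℕ → ℕ → ℤ³ → Set
InBallotRegion A B C (x , y , z) =
  (+ B * y ≤ + A * x) × (+ C * z ≤ + B * y) × (+ 0 ≤ + C * z)

IsBallotWalkTo : ℕ → ℕ → ℕ → ℤ³ → List ℤ³ → Set
IsBallotWalkTo A B C e ps =
  head ps ≡ just (+ 0 , + 0 , + 0) ×
  last ps ≡ just e ×
  Linked Step3 ps ×
  All (InBallotRegion A B C) ps

TandemStep : ℕ → ℕ → ℕ → ℤ² → ℤ² → Set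
TandemStep A B C (x , y) q =
  q ≡ (x + + A , y) ⊎ q ≡ (x - + B , y + + B) ⊎ q ≡ (x , y - + C)

InQuarterPlane : ℤ² → Set
InQuarterPlane (x , y) = (+ 0 ≤ x) × (+ 0 ≤ y)

IsTandemExcursion : ℕ → ℕ → ℕ → ℕ → List ℤ² → Set
IsTandemExcursion A B C L qs =
  length qs ≡ ℕ.suc L ×
  head qs ≡ just (+ 0 , + 0) ×
  last qs ≡ just (+ 0 , + 0) ×
  Linked (TandemStep A B C) qs ×
  All InQuarterPlane qs

φ : ℕ → ℕ → ℕ → ℤ³ → ℤ²
φ A B C (x , y , z) = (+ A * x - + B * y , + B * y - + C * z)

-- φ maps the three unit steps onto the three tandem steps, and each tandem step from φ p
-- lifts to a unit step from p.  The lift is unique, and the lifted excursion ends at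
-- (an, bn, cn), because φ is injective on every plane x + y + z = s: its kernel is spanned
-- by (a, b, c) (since Aa = Bb = Cc = M), on which the coordinate sum does not vanish.  The
-- region Ax ≥ By ≥ Cz corresponds to the quarter plane, and Cz ≥ 0 holds automatically along
-- a walk from the origin since z never decreases.

module Submission where

open import Defs
open import Data.Nat using (ℕ; _>_; _+_; _*_)
open import Data.Nat.GCD using (gcd)
open import Data.Integer using (+_)
open import Data.Product using (_×_; _,_; ∃-syntax)
open import Data.List using (List; map)
open import Relation.Binary.PropositionalEquality using (_≡_)

open import Data.Nat as ℕ using (suc; z≤n; s≤s)
open import Data.Nat.Properties as ℕ
  using (n≢0⇒n>0; n>0⇒n≢0; *-zeroʳ; *-assoc; *-distribʳ-+; *-mono-<)
open import Data.Nat.Divisibility using (_∣_; ∣-trans)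
open import Data.Nat.DivMod using (m/n*n≡m)
open import Data.Nat.LCM using (lcm; m∣lcm[m,n]; n∣lcm[m,n]; gcd*lcm)
open import Data.Integer using (ℤ; _≤_; +≤+; NonZero)
  renaming (_+_ to _⊕_; _*_ to _⊛_; _-_ to _⊝_)
import Data.Integer.Properties as ℤ
open import Data.Integer.Tactic.RingSolver using (solve-∀)
open import Data.Product using (proj₁; proj₂)
open import Data.Sum using (inj₁; inj₂)
open import Data.List using ([]; _∷_; length; last)
import Data.List.Properties as List
open import Data.List.Relation.Unary.All as All using (All; []; _∷_)
import Data.List.Relation.Unary.All.Properties as All
open import Data.List.Relation.Unary.Linked as Linked using (Linked; [-]; _∷_)
import Data.List.Relation.Unary.Linked.Properties as Linked
open import Data.Maybe using (just)
import Data.Maybe as Maybe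
import Data.Maybe.Properties as Maybe
open import Relation.Binary.PropositionalEquality
  using (refl; sym; trans; cong; cong₂; subst; module ≡-Reasoning)
open import Relation.Unary using (Pred)
open import Relation.Binary using (Rel)
open import Level using (0ℓ)

lcm>0 : ∀ {m n} → m > 0 → n > 0 → lcm m n > 0
lcm>0 {m} {n} m>0 n>0 = n≢0⇒n>0 λ lcm≡0 →
  n>0⇒n≢0 (*-mono-< m>0 n>0)
    (trans (sym (gcd*lcm m n)) (trans (cong (gcd m n *_) lcm≡0) (*-zeroʳ (gcd m n))))

m*n>0⇒m>0 : ∀ m n → m * n > 0 → m > 0
m*n>0⇒m>0 (suc m) n _ = s≤s z≤n

m*n>0⇒n>0 : ∀ m n → m * n > 0 → n > 0
m*n>0⇒n>0 m n mn>0 = m*n>0⇒m>0 n m (subst (_> 0) (ℕ.*-comm m n) mn>0)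

lastFrom : {X : Set} → X → List X → X
lastFrom x []       = x
lastFrom x (y ∷ ys) = lastFrom y ys

last-∷ : {X : Set} (x : X) (xs : List X) → last (x ∷ xs) ≡ just (lastFrom x xs)
last-∷ x []       = refl
last-∷ x (y ∷ ys) = last-∷ y ys

module _ {X : Set} {R : Rel X 0ℓ} where

  Linked-potential : (h : X → ℤ) → (∀ {p q} → R p q → h q ≡ h p ⊕ + 1) →
                     ∀ {p ps} → Linked R (p ∷ ps) → h (lastFrom p ps) ≡ h p ⊕ + length ps
  Linked-potential h step {p} {[]}     _        = sym (ℤ.+-identityʳ (h p))
  Linked-potential h step {p} {q ∷ qs} (r ∷ rs) = begin
    h (lastFrom q qs)            ≡⟨ Linked-potential h step rs ⟩
    h q ⊕ + length qs            ≡⟨ cong (_⊕ + length qs) (step r) ⟩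
    h p ⊕ + 1 ⊕ + length qs      ≡⟨ ℤ.+-assoc (h p) (+ 1) (+ length qs) ⟩
    h p ⊕ + length (q ∷ qs)      ∎
    where open ≡-Reasoning

  Linked-invariant : {P : Pred X 0ℓ} → (∀ {p q} → R p q → P p → P q) →
                     ∀ {p ps} → Linked R (p ∷ ps) → P p → All P (p ∷ ps)
  Linked-invariant pres {ps = []}    _        Pp = Pp ∷ []
  Linked-invariant pres {ps = _ ∷ _} (r ∷ rs) Pp = Pp ∷ Linked-invariant pres rs (pres r Pp)

  module _ {Y : Set} (f : X → Y) where

    Linked-lift : {S : Rel Y 0ℓ} → (∀ {p q} → S (f p) q → ∃[ p′ ] R p p′ × f p′ ≡ q) →
                  ∀ {p qs} → Linked S (f p ∷ qs) → ∃[ ps ] Linked R (p ∷ ps) × map f ps ≡ qs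
    Linked-lift lift {qs = []}    _ = [] , [-] , refl
    Linked-lift lift {qs = _ ∷ _} (s ∷ ss) with lift s
    ... | p′ , r , refl with Linked-lift lift ss
    ...   | ps , rs , refl = p′ ∷ ps , r ∷ rs , refl

    Linked-map-injective : (∀ {p q q′} → R p q → R p q′ → f q ≡ f q′ → q ≡ q′) →
                           ∀ {p ps ps′} → Linked R (p ∷ ps) → Linked R (p ∷ ps′) →
                           map f ps ≡ map f ps′ → ps ≡ ps′
    Linked-map-injective inj {ps = []}    {[]}     _        _          _  = refl
    Linked-map-injective inj {ps = _ ∷ _} {_ ∷ _} (r ∷ rs) (r′ ∷ rs′) eq
      with inj r r′ (List.∷-injectiveˡ eq)
    ... | refl = cong (_ ∷_) (Linked-map-injective inj rs rs′ (List.∷-injectiveʳ eq))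

lin-sucˡ : ∀ α β x y → α ⊛ (x ⊕ + 1) ⊝ β ⊛ y ≡ α ⊛ x ⊝ β ⊛ y ⊕ α
lin-sucˡ = solve-∀

lin-sucʳ : ∀ α β x y → α ⊛ x ⊝ β ⊛ (y ⊕ + 1) ≡ α ⊛ x ⊝ β ⊛ y ⊝ β
lin-sucʳ = solve-∀

lin-zero : ∀ α β → α ⊛ + 0 ⊝ β ⊛ + 0 ≡ + 0
lin-zero = solve-∀

lin-sub : ∀ α β x y x′ y′ →
          α ⊛ (x ⊝ x′) ⊝ β ⊛ (y ⊝ y′) ≡ (α ⊛ x ⊝ β ⊛ y) ⊝ (α ⊛ x′ ⊝ β ⊛ y′)
lin-sub = solve-∀

difference-balanced : ∀ α β {u v u′ v′} → α ⊛ u ⊝ β ⊛ v ≡ α ⊛ u′ ⊝ β ⊛ v′ →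
                      α ⊛ (u ⊝ u′) ≡ β ⊛ (v ⊝ v′)
difference-balanced α β {u} {v} {u′} {v′} eq =
  ℤ.i-j≡0⇒i≡j _ _ (trans (lin-sub α β u v u′ v′) (ℤ.i≡j⇒i-j≡0 eq))

sub-+₃ : ∀ x y z x′ y′ z′ →
         (x ⊝ x′) ⊕ (y ⊝ y′) ⊕ (z ⊝ z′) ≡ (x ⊕ y ⊕ z) ⊝ (x′ ⊕ y′ ⊕ z′)
sub-+₃ = solve-∀

distribʳ-+₃ : ∀ w x y z → (x ⊕ y ⊕ z) ⊛ w ≡ x ⊛ w ⊕ y ⊛ w ⊕ z ⊛ w
distribʳ-+₃ = solve-∀

distribˡ-+₃ : ∀ w x y z → w ⊛ (x ⊕ y ⊕ z) ≡ w ⊛ x ⊕ w ⊛ y ⊕ w ⊛ z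
distribˡ-+₃ = solve-∀

balanced∧sum≡0⇒≡0 : ∀ A B C a b c M .{{_ : NonZero M}} .{{_ : NonZero (a ⊕ b ⊕ c)}} →
                     A ⊛ a ≡ M → B ⊛ b ≡ M → C ⊛ c ≡ M →
                     ∀ {x y z} → A ⊛ x ≡ B ⊛ y → B ⊛ y ≡ C ⊛ z → x ⊕ y ⊕ z ≡ + 0 →
                     x ≡ + 0 × y ≡ + 0 × z ≡ + 0
balanced∧sum≡0⇒≡0 A B C a b c M Aa≡M Bb≡M Cc≡M {x} {y} {z} Ax≡By By≡Cz sum≡0 =
  vanish a x Mx≡aK , vanish b y My≡bK , vanish c z Mz≡cK
  where
  open ≡-Reasoning
  K : ℤ
  K = A ⊛ x

  rescale : ∀ D d {w} → D ⊛ d ≡ M → D ⊛ w ≡ K → M ⊛ w ≡ d ⊛ K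
  rescale D d {w} Dd≡M Dw≡K = begin
    M ⊛ w        ≡⟨ cong (_⊛ w) (sym Dd≡M) ⟩
    D ⊛ d ⊛ w    ≡⟨ cong (_⊛ w) (ℤ.*-comm D d) ⟩
    d ⊛ D ⊛ w    ≡⟨ ℤ.*-assoc d D w ⟩
    d ⊛ (D ⊛ w)  ≡⟨ cong (d ⊛_) Dw≡K ⟩
    d ⊛ K        ∎

  Mx≡aK : M ⊛ x ≡ a ⊛ K
  Mx≡aK = rescale A a Aa≡M refl
  My≡bK : M ⊛ y ≡ b ⊛ K
  My≡bK = rescale B b Bb≡M (sym Ax≡By)
  Mz≡cK : M ⊛ z ≡ c ⊛ K
  Mz≡cK = rescale C c Cc≡M (sym (trans Ax≡By By≡Cz))

  K≡0 : K ≡ + 0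
  K≡0 = ℤ.*-cancelˡ-≡ (a ⊕ b ⊕ c) K (+ 0) (begin
    (a ⊕ b ⊕ c) ⊛ K              ≡⟨ distribʳ-+₃ K a b c ⟩
    a ⊛ K ⊕ b ⊛ K ⊕ c ⊛ K        ≡⟨ cong₂ _⊕_ (cong₂ _⊕_ Mx≡aK My≡bK) Mz≡cK ⟨
    M ⊛ x ⊕ M ⊛ y ⊕ M ⊛ z        ≡⟨ distribˡ-+₃ M x y z ⟨
    M ⊛ (x ⊕ y ⊕ z)              ≡⟨ cong (M ⊛_) sum≡0 ⟩
    M ⊛ + 0                      ≡⟨ ℤ.*-zeroʳ M ⟩
    + 0                          ≡⟨ ℤ.*-zeroʳ (a ⊕ b ⊕ c) ⟨
    (a ⊕ b ⊕ c) ⊛ + 0            ∎)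

  vanish : ∀ d w → M ⊛ w ≡ d ⊛ K → w ≡ + 0
  vanish d w Mw≡dK = ℤ.*-cancelˡ-≡ M w (+ 0)
    (trans Mw≡dK (trans (cong (d ⊛_) K≡0) (trans (ℤ.*-zeroʳ d) (sym (ℤ.*-zeroʳ M)))))

origin : ℤ³
origin = (+ 0 , + 0 , + 0)

coordSum : ℤ³ → ℤ
coordSum (x , y , z) = x ⊕ y ⊕ z

zCoord : ℤ³ → ℤ
zCoord (_ , _ , z) = z

+1-shiftˣ : ∀ x y z → x ⊕ + 1 ⊕ y ⊕ z ≡ x ⊕ y ⊕ z ⊕ + 1
+1-shiftˣ = solve-∀

+1-shiftʸ : ∀ x y z → x ⊕ (y ⊕ + 1) ⊕ z ≡ x ⊕ y ⊕ z ⊕ + 1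
+1-shiftʸ = solve-∀

Step3-coordSum : ∀ {p q} → Step3 p q → coordSum q ≡ coordSum p ⊕ + 1
Step3-coordSum {x , y , z} (inj₁ refl)        = +1-shiftˣ x y z
Step3-coordSum {x , y , z} (inj₂ (inj₁ refl)) = +1-shiftʸ x y z
Step3-coordSum {x , y , z} (inj₂ (inj₂ refl)) = sym (ℤ.+-assoc (x ⊕ y) z (+ 1))

Step3-zCoord-nonNeg : ∀ {p q} → Step3 p q → + 0 ≤ zCoord p → + 0 ≤ zCoord q
Step3-zCoord-nonNeg         (inj₁ refl)        0≤z = 0≤z
Step3-zCoord-nonNeg         (inj₂ (inj₁ refl)) 0≤z = 0≤z
Step3-zCoord-nonNeg {_ , _ , z} (inj₂ (inj₂ refl)) 0≤z = ℤ.≤-trans 0≤z (ℤ.i≤i+j z (+ 1))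

module _ (A B C : ℕ) where

  φ-origin : φ A B C origin ≡ (+ 0 , + 0)
  φ-origin = cong₂ _,_ (lin-zero (+ A) (+ B)) (lin-zero (+ B) (+ C))

  φ-incˣ : ∀ x y z → φ A B C (x ⊕ + 1 , y , z) ≡
                     (+ A ⊛ x ⊝ + B ⊛ y ⊕ + A , + B ⊛ y ⊝ + C ⊛ z)
  φ-incˣ x y z = cong₂ _,_ (lin-sucˡ (+ A) (+ B) x y) refl

  φ-incʸ : ∀ x y z → φ A B C (x , y ⊕ + 1 , z) ≡
                     (+ A ⊛ x ⊝ + B ⊛ y ⊝ + B , + B ⊛ y ⊝ + C ⊛ z ⊕ + B)
  φ-incʸ x y z = cong₂ _,_ (lin-sucʳ (+ A) (+ B) x y) (lin-sucˡ (+ B) (+ C) y z)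

  φ-incᶻ : ∀ x y z → φ A B C (x , y , z ⊕ + 1) ≡
                     (+ A ⊛ x ⊝ + B ⊛ y , + B ⊛ y ⊝ + C ⊛ z ⊝ + C)
  φ-incᶻ x y z = cong₂ _,_ refl (lin-sucʳ (+ B) (+ C) y z)

  φ-step : ∀ {p q} → Step3 p q → TandemStep A B C (φ A B C p) (φ A B C q)
  φ-step {x , y , z} (inj₁ refl)        = inj₁ (φ-incˣ x y z)
  φ-step {x , y , z} (inj₂ (inj₁ refl)) = inj₂ (inj₁ (φ-incʸ x y z))
  φ-step {x , y , z} (inj₂ (inj₂ refl)) = inj₂ (inj₂ (φ-incᶻ x y z))

  φ-lift-step : ∀ {p q} → TandemStep A B C (φ A B C p) q →
                ∃[ p′ ] Step3 p p′ × φ A B C p′ ≡ q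
  φ-lift-step {x , y , z} (inj₁ refl)        = _ , inj₁ refl , φ-incˣ x y z
  φ-lift-step {x , y , z} (inj₂ (inj₁ refl)) = _ , inj₂ (inj₁ refl) , φ-incʸ x y z
  φ-lift-step {x , y , z} (inj₂ (inj₂ refl)) = _ , inj₂ (inj₂ refl) , φ-incᶻ x y z

  ballot⇒quarter : ∀ {p} → InBallotRegion A B C p → InQuarterPlane (φ A B C p)
  ballot⇒quarter (By≤Ax , Cz≤By , _) = ℤ.i≤j⇒0≤j-i By≤Ax , ℤ.i≤j⇒0≤j-i Cz≤By

  quarter⇒ballot : ∀ {p} → + 0 ≤ zCoord p → InQuarterPlane (φ A B C p) → InBallotRegion A B C p
  quarter⇒ballot {_ , _ , z} 0≤z (0≤Ax-By , 0≤By-Cz) =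
    ℤ.0≤i-j⇒j≤i 0≤Ax-By , ℤ.0≤i-j⇒j≤i 0≤By-Cz ,
    subst (_≤ + C ⊛ z) (ℤ.*-zeroʳ (+ C)) (ℤ.*-monoˡ-≤-nonNeg (+ C) 0≤z)

last-map-lastFrom : {X Y : Set} (f : X → Y) (x : X) (xs : List X) →
                    last (map f (x ∷ xs)) ≡ just (f (lastFrom x xs))
last-map-lastFrom f x xs = trans (List.last-map f (x ∷ xs)) (cong (Maybe.map f) (last-∷ x xs))

walk-coordSum : ∀ {ps} → Linked Step3 (origin ∷ ps) → coordSum (lastFrom origin ps) ≡ + length ps
walk-coordSum = Linked-potential coordSum Step3-coordSum

walk-zCoord-nonNeg : ∀ {ps} → Linked Step3 (origin ∷ ps) →
                     All (λ p → + 0 ≤ zCoord p) (origin ∷ ps)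
walk-zCoord-nonNeg steps = Linked-invariant Step3-zCoord-nonNeg steps (+≤+ z≤n)

module BallotTandem (A B C a b c M : ℕ)
  (Aa≡M : A * a ≡ M) (Bb≡M : B * b ≡ M) (Cc≡M : C * c ≡ M) (M>0 : M > 0) where

  private
    pos-weight : ∀ D d → D * d ≡ M → + D ⊛ + d ≡ + M
    pos-weight D d Dd≡M = trans (sym (ℤ.pos-* D d)) (cong +_ Dd≡M)

    a+b+c>0 : a + b + c > 0
    a+b+c>0 = ℕ.<-≤-trans (m*n>0⇒n>0 A a (subst (_> 0) (sym Aa≡M) M>0))
                          (ℕ.≤-trans (ℕ.m≤m+n a b) (ℕ.m≤m+n (a + b) c))

  φ-injective-on-level : ∀ {p p′} → φ A B C p ≡ φ A B C p′ → coordSum p ≡ coordSum p′ →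
                         p ≡ p′
  φ-injective-on-level {x , y , z} {x′ , y′ , z′} φp≡φp′ sum≡sum′
    with balanced∧sum≡0⇒≡0 (+ A) (+ B) (+ C) (+ a) (+ b) (+ c) (+ M)
           {{ℕ.>-nonZero M>0}} {{ℕ.>-nonZero a+b+c>0}}
           (pos-weight A a Aa≡M) (pos-weight B b Bb≡M) (pos-weight C c Cc≡M)
           (difference-balanced (+ A) (+ B) (cong proj₁ φp≡φp′))
           (difference-balanced (+ B) (+ C) (cong proj₂ φp≡φp′))
           (trans (sub-+₃ x y z x′ y′ z′) (ℤ.i≡j⇒i-j≡0 sum≡sum′))
  ... | dx≡0 , dy≡0 , dz≡0 =
    cong₂ _,_ (ℤ.i-j≡0⇒i≡j x x′ dx≡0)
              (cong₂ _,_ (ℤ.i-j≡0⇒i≡j y y′ dy≡0) (ℤ.i-j≡0⇒i≡j z z′ dz≡0))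

  module _ (n : ℕ) where

    private
      end : ℤ³
      end = (+ (a * n) , + (b * n) , + (c * n))

      weighted-end : ∀ D d → D * d ≡ M → + D ⊛ + (d * n) ≡ + (M * n)
      weighted-end D d Dd≡M =
        trans (sym (ℤ.pos-* D (d * n))) (cong +_ (trans (sym (*-assoc D d n)) (cong (_* n) Dd≡M)))

      φ-end : φ A B C end ≡ (+ 0 , + 0)
      φ-end = cong₂ _,_
        (ℤ.i≡j⇒i-j≡0 (trans (weighted-end A a Aa≡M) (sym (weighted-end B b Bb≡M))))
        (ℤ.i≡j⇒i-j≡0 (trans (weighted-end B b Bb≡M) (sym (weighted-end C c Cc≡M))))

      coordSum-end : coordSum end ≡ + ((a + b + c) * n)
      coordSum-end = cong +_ (sym (trans (*-distribʳ-+ n (a + b) c) (cong (_+ c * n) (*-distribʳ-+ n a b))))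

      end-unique : ∀ {r} → φ A B C r ≡ (+ 0 , + 0) → coordSum r ≡ + ((a + b + c) * n) → r ≡ end
      end-unique φr≡0 sum≡ =
        φ-injective-on-level (trans φr≡0 (sym φ-end)) (trans sum≡ (sym coordSum-end))

    ballot-walk⇒excursion : ∀ ps → IsBallotWalkTo A B C end ps →
                            IsTandemExcursion A B C ((a + b + c) * n) (map (φ A B C) ps)
    ballot-walk⇒excursion (_ ∷ ps) (refl , last≡end , steps , inRegion) =
      cong suc (trans (List.length-map (φ A B C) ps) length≡) ,
      cong just (φ-origin A B C) ,
      trans (last-map-lastFrom (φ A B C) origin ps)
            (cong just (trans (cong (φ A B C) lastFrom≡end) φ-end)) ,
      Linked.map⁺ (Linked.map (φ-step A B C) steps) ,
      All.map⁺ (All.map (ballot⇒quarter A B C) inRegion)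
      where
      lastFrom≡end : lastFrom origin ps ≡ end
      lastFrom≡end = Maybe.just-injective (trans (sym (last-∷ origin ps)) last≡end)
      length≡ : length ps ≡ (a + b + c) * n
      length≡ = ℤ.+-injective
        (trans (sym (walk-coordSum steps)) (trans (cong coordSum lastFrom≡end) coordSum-end))

    ballot-walk-φ-injective : ∀ ps ps′ →
                              IsBallotWalkTo A B C end ps → IsBallotWalkTo A B C end ps′ →
                              map (φ A B C) ps ≡ map (φ A B C) ps′ → ps ≡ ps′
    ballot-walk-φ-injective (_ ∷ _) (_ ∷ _) (refl , _ , steps , _) (refl , _ , steps′ , _) φps≡φps′ =
      cong (origin ∷_)
        (Linked-map-injective (φ A B C) successor-injective steps steps′ (List.∷-injectiveʳ φps≡φps′))
      where
      successor-injective : ∀ {p q q′} → Step3 p q → Step3 p q′ →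
                            φ A B C q ≡ φ A B C q′ → q ≡ q′
      successor-injective s s′ φq≡φq′ =
        φ-injective-on-level φq≡φq′ (trans (Step3-coordSum s) (sym (Step3-coordSum s′)))

    excursion⇒ballot-walk : ∀ qs → IsTandemExcursion A B C ((a + b + c) * n) qs →
                            ∃[ ps ] IsBallotWalkTo A B C end ps × map (φ A B C) ps ≡ qs
    excursion⇒ballot-walk (_ ∷ qs) (length≡ , refl , last≡0 , steps , inQuarter)
      with Linked-lift (φ A B C) (φ-lift-step A B C)
             (subst (λ o → Linked (TandemStep A B C) (o ∷ qs)) (sym (φ-origin A B C)) steps)
    ... | ps , steps′ , refl =
      origin ∷ ps ,
      (refl , trans (last-∷ origin ps) (cong just lastFrom≡end) , steps′ , inRegion) ,
      φ-walk
      where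
      φ-walk : map (φ A B C) (origin ∷ ps) ≡ (+ 0 , + 0) ∷ map (φ A B C) ps
      φ-walk = cong (_∷ map (φ A B C) ps) (φ-origin A B C)
      φ-lastFrom : φ A B C (lastFrom origin ps) ≡ (+ 0 , + 0)
      φ-lastFrom = Maybe.just-injective
        (trans (sym (last-map-lastFrom (φ A B C) origin ps)) (trans (cong last φ-walk) last≡0))
      lastFrom≡end : lastFrom origin ps ≡ end
      lastFrom≡end = end-unique φ-lastFrom
        (trans (walk-coordSum steps′)
               (cong +_ (trans (sym (List.length-map (φ A B C) ps)) (ℕ.suc-injective length≡))))
      inRegion : All (InBallotRegion A B C) (origin ∷ ps)
      inRegion = All.zipWith (λ (0≤z , inQ) → quarter⇒ballot A B C 0≤z inQ)
        (walk-zCoord-nonNeg steps′ , All.map⁻ (subst (All InQuarterPlane) (sym φ-walk) inQuarter))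

divPos-*-cancel : ∀ m d (d>0 : d > 0) → d ∣ m → divPos m d d>0 * d ≡ m
divPos-*-cancel m d d>0 = m/n*n≡m {{ℕ.>-nonZero d>0}}

m∣lcm3 : ∀ m n o → m ∣ lcm3 m n o
m∣lcm3 m n o = m∣lcm[m,n] m (lcm n o)

n∣lcm3 : ∀ m n o → n ∣ lcm3 m n o
n∣lcm3 m n o = ∣-trans (m∣lcm[m,n] n o) (n∣lcm[m,n] m (lcm n o))

o∣lcm3 : ∀ m n o → o ∣ lcm3 m n o
o∣lcm3 m n o = ∣-trans (n∣lcm[m,n] n o) (n∣lcm[m,n] m (lcm n o))

lemma1 : (a b c : ℕ) (a>0 : a > 0) (b>0 : b > 0) (c>0 : c > 0) →
    gcd a (gcd b c) ≡ 1 → (n : ℕ) →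
    let M = lcm3 a b c
        A = divPos M a a>0
        B = divPos M b b>0
        C = divPos M c c>0
        e = (+ (a * n) , + (b * n) , + (c * n))
        L = (a + b + c) * n
    in ((ps : List ℤ³) → IsBallotWalkTo A B C e ps →
          IsTandemExcursion A B C L (map (φ A B C) ps))
       × ((ps ps′ : List ℤ³) → IsBallotWalkTo A B C e ps → IsBallotWalkTo A B C e ps′ →
          map (φ A B C) ps ≡ map (φ A B C) ps′ → ps ≡ ps′)
       × ((qs : List ℤ²) → IsTandemExcursion A B C L qs →
          ∃[ ps ] (IsBallotWalkTo A B C e ps × map (φ A B C) ps ≡ qs))
lemma1 a b c a>0 b>0 c>0 _ n =
  ballot-walk⇒excursion n , ballot-walk-φ-injective n , excursion⇒ballot-walk n
  where
  M : ℕ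
  M = lcm3 a b c
  A B C : ℕ
  A = divPos M a a>0
  B = divPos M b b>0
  C = divPos M c c>0
  open BallotTandem A B C a b c M
    (divPos-*-cancel M a a>0 (m∣lcm3 a b c))
    (divPos-*-cancel M b b>0 (n∣lcm3 a b c))
    (divPos-*-cancel M c c>0 (o∣lcm3 a b c))
    (lcm>0 a>0 (lcm>0 b>0 c>0))
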